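{- Let $M$ be such that $X_0(M)$ has genus zero, i.e. $1 \le M \le 10$ or $M \in \{12, 13, 16, 18, 25\}$. Let $s \in X_0(M)$ be a cusp expressed as $s = m/M = W_m^M(i\infty)$ with an integer $0 \le m < M$, where $W_m^M$ is a generalized Atkin-Lehner involution. \begin{enumerate} \item If $(M, s) \notin \{(25, 1/5), (25, 2/5), (25, 3/5), (25, 4/5)\}$, then $W_m^M \in N_{\mathrm{SL}_2(\mathbb{R})}(\Gamma_0(M))$. \item If \[ (M, s) \notin \left\{ \begin{gathered} (9, 1/3), (9, 2/3), \\ (16, 1/2), (16, 1/4), (16, 3/4), (16, 1/8), \\ (18, 1/3), (18, 2/3), (18, 1/6), (18, 5/6), \\ (25, 1/5), (25, 2/5), (25, 3/5), (25, 4/5) \end{gathered} \right\}, \] then $W_m^M \in N_{\mathrm{SL}_2(\mathbb{R})}(G_0(M))$. \item If $M = 25$ and $s \in \{1/5, 2/5, 3/5, 4/5\}$, then $W_m^M \in N_{\mathrm{SL}_2(\mathbb{R})}(\Gamma_0^{(5)}(25))$. \end{enumerate}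
   Context: Here $(x,y)$ denotes the greatest common divisor. $\Gamma_0(M) = \{\gamma \in \mathrm{SL}_2(\mathbb{Z}) : \gamma \equiv \begin{pmatrix} * & * \\ 0 & * \end{pmatrix} \bmod M\}$, $X_0(M) = \Gamma_0(M)\backslash(\mathbb{H} \cup \mathbb{Q} \cup \{i\infty\})$, and cusps are elements of $\Gamma_0(M)\backslash(\mathbb{Q}\cup\{i\infty\})$. Let $\mathbb{Z}_{(M)} = \{a/b \in \mathbb{Q} : a,b \in \mathbb{Z}, (b,M)=1\}$, $\mathrm{GL}_2(\mathbb{Z}_{(M)}) = \{\gamma \in M_2(\mathbb{Z}_{(M)}) : \det\gamma \in \mathbb{Z}_{(M)}^\times\}$, and $G_0(M) = \{\gamma \in \mathrm{GL}_2(\mathbb{Z}_{(M)}) : \gamma \equiv \begin{pmatrix} * & * \\ 0 & * \end{pmatrix} \bmod M\mathbb{Z}_{(M)}\}$. For a positive divisor $M'$ of $M$, $\Gamma_0^{(M')}(M) = \{\begin{pmatrix} a & * \\ * & d\end{pmatrix} \in \Gamma_0(M) : a \equiv d \bmod M'\}$. For an integer $m$, put $D := (M, m^2)$, choose integers $u, v$ with $(M,m) m v - M u = D$, and define the generalized Atkin-Lehner involution $W_m^M := \frac{1}{\sqrt{D}}\begin{pmatrix} m & u \\ M & (M,m) v\end{pmatrix} \in \mathrm{SL}_2(\mathbb{R})$. For a group $G$ and subgroup $H$, $N_G(H)$ denotes the normalizer of $H$ in $G$. -}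

module Defs where

open import Data.Nat as ℕ using (ℕ; zero; suc)
open import Data.Nat.GCD using (gcd)
open import Data.Integer as ℤ using (ℤ; +_)
open import Data.Rational as ℚ using (ℚ; _/_; 0ℚ; 1ℚ; ↥_; ↧ₙ_)
open import Data.Product using (_×_; _,_; Σ; ∃)
open import Data.List using (List; []; _∷_)
open import Data.List.Membership.Propositional using (_∈_)
open import Relation.Binary.PropositionalEquality using (_≡_)

record Mat (A : Set) : Set where
  constructor mat
  field
    a b c d : A
open Mat public

ι : ℤ → ℚ
ι z = z / 1

_⊗_ : Mat ℚ → Mat ℚ → Mat ℚ
mat a₁ b₁ c₁ d₁ ⊗ mat a₂ b₂ c₂ d₂ =
  mat (a₁ ℚ.* a₂ ℚ.+ b₁ ℚ.* c₂) (a₁ ℚ.* b₂ ℚ.+ b₁ ℚ.* d₂)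
      (c₁ ℚ.* a₂ ℚ.+ d₁ ℚ.* c₂) (c₁ ℚ.* b₂ ℚ.+ d₁ ℚ.* d₂)

scale : ℚ → Mat ℚ → Mat ℚ
scale s (mat a b c d) = mat (s ℚ.* a) (s ℚ.* b) (s ℚ.* c) (s ℚ.* d)

adj : Mat ℚ → Mat ℚ
adj (mat a b c d) = mat d (ℚ.- b) (ℚ.- c) a

det : Mat ℚ → ℚ
det (mat a b c d) = a ℚ.* d ℚ.- b ℚ.* c

-- 1/n for n ≥ 1 (only used with n ≥ 1)
recipℕ : ℕ → ℚ
recipℕ zero = 0ℚ
recipℕ (suc k) = + 1 / suc k

IsInt : ℚ → Set
IsInt q = ↧ₙ q ≡ 1

InZM : ℕ → ℚ → Set
InZM M q = gcd (↧ₙ q) M ≡ 1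

InΓ₀ : ℕ → Mat ℚ → Set
InΓ₀ M (mat a b c d) =
  IsInt a × IsInt b × IsInt d ×
  (Σ ℚ λ k → IsInt k × c ≡ ι (+ M) ℚ.* k) ×
  det (mat a b c d) ≡ 1ℚ

InΓ₀⁽_⁾ : ℕ → ℕ → Mat ℚ → Set
InΓ₀⁽ M' ⁾ M γ =
  InΓ₀ M γ × (Σ ℚ λ k → IsInt k × a γ ℚ.- d γ ≡ ι (+ M') ℚ.* k)

InG₀ : ℕ → Mat ℚ → Set
InG₀ M (mat a b c d) =
  InZM M a × InZM M b × InZM M d ×
  (Σ ℚ λ k → InZM M k × c ≡ ι (+ M) ℚ.* k) ×
  (InZM M (det (mat a b c d)) ×
   (Σ ℚ λ e → InZM M e × det (mat a b c d) ℚ.* e ≡ 1ℚ))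

-- Generalized Atkin–Lehner involution  W_m^M = (1/√D) A,
--   A = (m u ; M (M,m)v),  D = (M, m²),  (M,m) m v - M u = D.

Dval : ℕ → ℕ → ℕ
Dval M m = gcd M (m ℕ.* m)

ALCond : ℕ → ℕ → ℤ → ℤ → Set
ALCond M m u v =
  (+ gcd M m) ℤ.* (+ m) ℤ.* v ℤ.- (+ M) ℤ.* u ≡ + Dval M m

ALmat : ℕ → ℕ → ℤ → ℤ → Mat ℚ
ALmat M m u v = mat (ι (+ m)) (ι u) (ι (+ M)) (ι ((+ gcd M m) ℤ.* v))

-- W γ W⁻¹ , computed exactly: (1/√D)A γ ((1/√D)A)⁻¹ = A γ adj(A) / D
conjW : ℕ → ℕ → ℤ → ℤ → Mat ℚ → Mat ℚ
conjW M m u v γ =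
  scale (recipℕ (Dval M m)) ((ALmat M m u v ⊗ γ) ⊗ adj (ALmat M m u v))

conjW⁻¹ : ℕ → ℕ → ℤ → ℤ → Mat ℚ → Mat ℚ
conjW⁻¹ M m u v γ =
  scale (recipℕ (Dval M m)) ((adj (ALmat M m u v) ⊗ γ) ⊗ ALmat M m u v)

InNormalizer : (Mat ℚ → Set) → ℕ → ℕ → ℤ → ℤ → Set
InNormalizer H M m u v =
  (∀ γ → H γ → H (conjW M m u v γ)) ×
  (∀ γ → H γ → H (conjW⁻¹ M m u v γ))

genusZeroLevels : List ℕ
genusZeroLevels =
  1 ∷ 2 ∷ 3 ∷ 4 ∷ 5 ∷ 6 ∷ 7 ∷ 8 ∷ 9 ∷ 10 ∷ 12 ∷ 13 ∷ 16 ∷ 18 ∷ 25 ∷ []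

cusp : ℕ → ℕ → ℚ
cusp zero m = 0ℚ
cusp (suc k) m = + m / suc k

q : ℕ → ℕ → ℚ
q n (suc k) = + n / suc k
q n zero = 0ℚ

exceptions₁ : List (ℕ × ℚ)
exceptions₁ =
  (25 , q 1 5) ∷ (25 , q 2 5) ∷ (25 , q 3 5) ∷ (25 , q 4 5) ∷ []

exceptions₂ : List (ℕ × ℚ)
exceptions₂ =
  (9 , q 1 3) ∷ (9 , q 2 3) ∷
  (16 , q 1 2) ∷ (16 , q 1 4) ∷ (16 , q 3 4) ∷ (16 , q 1 8) ∷
  (18 , q 1 3) ∷ (18 , q 2 3) ∷ (18 , q 1 6) ∷ (18 , q 5 6) ∷
  (25 , q 1 5) ∷ (25 , q 2 5) ∷ (25 , q 3 5) ∷ (25 , q 4 5) ∷ []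

cusps25 : List ℚ
cusps25 = q 1 5 ∷ q 2 5 ∷ q 3 5 ∷ q 4 5 ∷ []

{-# OPTIONS --safe #-}
-- Write W = A/√D with A = (m u ; M (M,m)v), so that W γ W⁻¹ = δ·A γ adj(A) with δ = 1/D.
-- Expanding this for γ = (a b ; Mk d), the entries of the conjugate are polynomials in the
-- entries of γ and in δM, δm², δ(M,m)²v², apart from the two products δm(a − d) and
-- δ(M,m)v(a − d); its lower-left entry is again a multiple of M and its determinant is det γ.
-- With h = D/(M,m) both products are integral once a ≡ d (mod h), so W normalizes a group
-- as soon as membership forces a ≡ d (mod h). In Γ₀(M) one knows ad ≡ 1 (mod h), which
-- suffices when every unit of ℤ/hℤ is an involution; in G₀(M) one only knows that a and d are
-- units mod h, which suffices for h ≤ 2 (parity in ℤ_(M)). In Γ₀⁽⁵⁾(25), a ≡ d (mod 5) is part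
-- of the definition and survives conjugation because 5 divides δ·25·m and δ·25·(25,m).
-- Computing h at the fifteen genus-zero levels leaves exactly the listed exceptions.
module Submission where

open import Defs
open import Data.Integer as ℤ using (ℤ; +_; 1ℤ)
open import Data.Integer.DivMod using (_%ℕ_; _/ℕ_; a≡a%ℕn+[a/ℕn]*n; n%ℕd<d)
import Data.Integer.Divisibility.Signed as ℤ∣
import Data.Integer.Properties as ℤP
open import Data.Integer.Tactic.RingSolver using (solve-∀)
open import Data.List.Membership.Propositional using (_∈_; _∉_)
import Data.List.Membership.DecPropositional as DecMembership
open import Data.List.Relation.Unary.All as All using (All)
open import Data.Nat as ℕ using (ℕ; zero; suc; NonZero; _<_)
open import Data.Nat.Coprimality as Coprime
  using (Coprime; coprime-divisor; coprime⇒gcd≡1; gcd≡1⇒coprime; 1-coprimeTo; 0-coprimeTo-m⇒m≡1)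
open import Data.Nat.DivMod using (_/_; m*[n/m]≡n)
import Data.Nat.Divisibility as ℕ∣
open import Data.Nat.GCD using (gcd; gcd[m,n]≢0; gcd[m,n]∣m; gcd[m,n]∣n; gcd-greatest; c*gcd[m,n]≡gcd[cm,cn])
import Data.Nat.Properties as ℕP
import Data.Nat.Tactic.RingSolver as ℕSolver
open import Data.Product using (Σ; _×_; _,_; proj₁; proj₂)
open import Data.Product.Properties using (≡-dec)
open import Data.Rational as ℚ using (ℚ; mkℚ; 1ℚ; ½; toℚᵘ; ↥_; ↧_; ↧ₙ_; _+_; _*_; _-_; -_)
import Data.Rational.Properties as ℚP
open import Data.Rational.Solver using (module +-*-Solver)
open +-*-Solver using (solve; _:+_; _:*_; _:-_; :-_; _:=_; con)
import Data.Rational.Unnormalised as ℚᵘ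
open import Data.Rational.Unnormalised using (mkℚᵘ)
import Data.Rational.Unnormalised.Properties as ℚᵘP
open import Data.Sum using (_⊎_; inj₁; inj₂; [_,_]′)
open import Function using (_∘_; id)
open import Relation.Binary.PropositionalEquality
open import Relation.Nullary using (¬_; contradiction)
open import Relation.Nullary.Decidable using (Dec; _×-dec_; _⊎-dec_; _→-dec_; from-yes)

private
  ι≡mkℚ : ∀ z → ι z ≡ mkℚ z 0 (Coprime.sym (1-coprimeTo _))
  ι≡mkℚ z = ℚP.↥p/↧p≡p (mkℚ z 0 _)

ι-homo-+ : ∀ x y → ι (x ℤ.+ y) ≡ ι x + ι y
ι-homo-+ x y = sym (begin
  ι x + ι y                                      ≡⟨ cong₂ _+_ (ι≡mkℚ x) (ι≡mkℚ y) ⟩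
  (x ℤ.* + 1 ℤ.+ y ℤ.* + 1) ℚ./ 1                 ≡⟨ cong (ℚ._/ 1) (cong₂ ℤ._+_ (ℤP.*-identityʳ x) (ℤP.*-identityʳ y)) ⟩
  ι (x ℤ.+ y)                                    ∎)
  where open ≡-Reasoning

ι-homo-* : ∀ x y → ι (x ℤ.* y) ≡ ι x * ι y
ι-homo-* x y = sym (cong₂ _*_ (ι≡mkℚ x) (ι≡mkℚ y))

ι-homo‿- : ∀ x → ι (ℤ.- x) ≡ - ι x
ι-homo‿- x = trans (ι≡mkℚ (ℤ.- x)) (trans (neg-mkℚ x) (cong -_ (sym (ι≡mkℚ x))))
  where
  neg-mkℚ : ∀ x → mkℚ (ℤ.- x) 0 (Coprime.sym (1-coprimeTo _)) ≡ - mkℚ x 0 (Coprime.sym (1-coprimeTo _))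
  neg-mkℚ (+ zero)   = refl
  neg-mkℚ (+ suc _)  = refl
  neg-mkℚ ℤ.-[1+ _ ] = refl

ι-homo-minus : ∀ x y → ι (x ℤ.- y) ≡ ι x - ι y
ι-homo-minus x y = trans (ι-homo-+ x (ℤ.- y)) (cong (λ t → ι x + t) (ι-homo‿- y))

ι-injective : ∀ {x y} → ι x ≡ ι y → x ≡ y
ι-injective {x} {y} eq = cong ↥_ (trans (sym (ι≡mkℚ x)) (trans eq (ι≡mkℚ y)))

IsInt-ι : ∀ z → IsInt (ι z)
IsInt-ι z = cong ↧ₙ_ (ι≡mkℚ z)

IsInt⇒≡ι↥ : ∀ {x} → IsInt x → x ≡ ι (↥ x)
IsInt⇒≡ι↥ {mkℚ n zero _} refl = sym (ι≡mkℚ n)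

ι-∣-factor : ∀ {h n} → (h∣n : h ℕ∣.∣ n) → ι (+ n) ≡ ι (+ h) * ι (+ ℕ∣.quotient h∣n)
ι-∣-factor {h} (ℕ∣.divides q refl) =
  trans (cong ι (ℤP.pos-* q h)) (trans (ι-homo-* (+ q) (+ h)) (ℚP.*-comm (ι (+ q)) (ι (+ h))))

*-↧≡↥ : ∀ x → x * ι (+ ↧ₙ x) ≡ ι (↥ x)
*-↧≡↥ x@(mkℚ N n-1 _) = ℚP.toℚᵘ-injective (begin
  toℚᵘ (x * ι (+ n))                      ≈⟨ ℚP.toℚᵘ-homo-* x (ι (+ n)) ⟩
  toℚᵘ x ℚᵘ.* toℚᵘ (ι (+ n))              ≡⟨ cong (λ y → toℚᵘ x ℚᵘ.* toℚᵘ y) (ι≡mkℚ (+ n)) ⟩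
  mkℚᵘ N n-1 ℚᵘ.* mkℚᵘ (+ n) 0
    ≈⟨ ℚᵘ.*≡* (trans (ℤP.*-identityʳ _) (cong (N ℤ.*_) (cong +_ (sym (ℕP.*-identityʳ n))))) ⟩
  mkℚᵘ N 0                                ≡⟨ cong toℚᵘ (ι≡mkℚ N) ⟨
  toℚᵘ (ι N)                              ∎)
  where
  open ℚᵘP.≃-Reasoning
  n = suc n-1

recipℕ-inverse : ∀ n .{{_ : NonZero n}} → recipℕ n * ι (+ n) ≡ 1ℚ
recipℕ-inverse (suc n) =
  trans (cong₂ _*_ recip≡ (ι≡mkℚ (+ suc n))) (ℚP.*-inverseˡ (mkℚ (+ suc n) 0 (Coprime.sym (1-coprimeTo _))))
  where
  recip≡ : recipℕ (suc n) ≡ ℚ.1/ mkℚ (+ suc n) 0 (Coprime.sym (1-coprimeTo _))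
  recip≡ = ℚP.normalize-coprime (1-coprimeTo (suc n))

recipℕ-cancel : ∀ {n x} .{{_ : NonZero n}} → (n∣x : n ℕ∣.∣ x) → recipℕ n * ι (+ x) ≡ ι (+ ℕ∣.quotient n∣x)
recipℕ-cancel {n} n∣x@(ℕ∣.divides q refl) = begin
  recipℕ n * ι (+ (q ℕ.* n))            ≡⟨ cong (recipℕ n *_) (ι-∣-factor n∣x) ⟩
  recipℕ n * (ι (+ n) * ι (+ q))        ≡⟨ ℚP.*-assoc (recipℕ n) (ι (+ n)) (ι (+ q)) ⟨
  recipℕ n * ι (+ n) * ι (+ q)          ≡⟨ cong (_* ι (+ q)) (recipℕ-inverse n) ⟩
  1ℚ * ι (+ q)                          ≡⟨ ℚP.*-identityˡ (ι (+ q)) ⟩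
  ι (+ q)                               ∎
  where open ≡-Reasoning

recipℕ-cancel-* : ∀ {n} x y .{{_ : NonZero n}} → (n∣xy : n ℕ∣.∣ x ℕ.* y) →
                  recipℕ n * ι (+ x) * ι (+ y) ≡ ι (+ ℕ∣.quotient n∣xy)
recipℕ-cancel-* {n} x y n∣xy = begin
  recipℕ n * ι (+ x) * ι (+ y)          ≡⟨ ℚP.*-assoc (recipℕ n) (ι (+ x)) (ι (+ y)) ⟩
  recipℕ n * (ι (+ x) * ι (+ y))        ≡⟨ cong (recipℕ n *_) (trans (cong ι (ℤP.pos-* x y)) (ι-homo-* (+ x) (+ y))) ⟨
  recipℕ n * ι (+ (x ℕ.* y))            ≡⟨ recipℕ-cancel n∣xy ⟩
  ι (+ ℕ∣.quotient n∣xy)                ∎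
  where open ≡-Reasoning

record Subring (R : ℚ → Set) : Set where
  field
    ι∈ : ∀ z → R (ι z)
    +∈ : ∀ {x y} → R x → R y → R (x + y)
    *∈ : ∀ {x y} → R x → R y → R (x * y)
    -∈ : ∀ {x} → R x → R (- x)

  1∈ : R 1ℚ
  1∈ = ι∈ (+ 1)

  ∸∈ : ∀ {x y} → R x → R y → R (x - y)
  ∸∈ x∈ y∈ = +∈ x∈ (-∈ y∈)

  ∈-resp : ∀ {x y} → x ≡ y → R y → R x
  ∈-resp x≡y = subst R (sym x≡y)

Subring-⇔ : ∀ {R R′ : ℚ → Set} → (∀ {x} → R x → R′ x) → (∀ {x} → R′ x → R x) →
            Subring R → Subring R′
Subring-⇔ to from S = record
  { ι∈ = to ∘ ι∈
  ; +∈ = λ x∈ y∈ → to (+∈ (from x∈) (from y∈))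
  ; *∈ = λ x∈ y∈ → to (*∈ (from x∈) (from y∈))
  ; -∈ = to ∘ -∈ ∘ from
  }
  where open Subring S

private
  ∣-of-ℤ-equation : ∀ {n x y} → + n ℤ.* x ≡ y → n ℕ∣.∣ ℤ.∣ y ∣
  ∣-of-ℤ-equation {n} {x} refl = ℕ∣.divides ℤ.∣ x ∣ (trans (ℤP.abs-* (+ n) x) (ℕP.*-comm n ℤ.∣ x ∣))

↧ₙ-+-∣ : ∀ p q → ↧ₙ (p + q) ℕ∣.∣ ↧ₙ p ℕ.* ↧ₙ q
↧ₙ-+-∣ p q = subst (↧ₙ (p + q) ℕ∣.∣_) (ℤP.abs-* (↧ p) (↧ q)) (∣-of-ℤ-equation (ℚP.↧-+ p q))

↧ₙ-*-∣ : ∀ p q → ↧ₙ (p * q) ℕ∣.∣ ↧ₙ p ℕ.* ↧ₙ q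
↧ₙ-*-∣ p q = subst (↧ₙ (p * q) ℕ∣.∣_) (ℤP.abs-* (↧ p) (↧ q)) (∣-of-ℤ-equation (ℚP.↧-* p q))

coprime-* : ∀ {a b n} → Coprime a n → Coprime b n → Coprime (a ℕ.* b) n
coprime-* {a} {b} {n} a⊥n b⊥n {i} (i∣ab , i∣n) = b⊥n (coprime-divisor i⊥a i∣ab , i∣n)
  where
  i⊥a : Coprime i a
  i⊥a (j∣i , j∣a) = a⊥n (j∣a , ℕ∣.∣-trans j∣i i∣n)

coprime-∣ : ∀ {a b n} → a ℕ∣.∣ b → Coprime b n → Coprime a n
coprime-∣ a∣b b⊥n (i∣a , i∣n) = b⊥n (ℕ∣.∣-trans i∣a a∣b , i∣n)

DenominatorCoprimeTo : ℕ → ℚ → Set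
DenominatorCoprimeTo n x = Coprime (↧ₙ x) n

DenominatorCoprimeTo-subring : ∀ n → Subring (DenominatorCoprimeTo n)
DenominatorCoprimeTo-subring n = record
  { ι∈ = λ z → subst (λ d → Coprime d n) (sym (IsInt-ι z)) (1-coprimeTo n)
  ; +∈ = λ {x} {y} x∈ y∈ → coprime-∣ (↧ₙ-+-∣ x y) (coprime-* x∈ y∈)
  ; *∈ = λ {x} {y} x∈ y∈ → coprime-∣ (↧ₙ-*-∣ x y) (coprime-* x∈ y∈)
  ; -∈ = λ {x} x∈ → subst (λ d → Coprime d n) (sym (cong ℤ.∣_∣ (ℚP.↧-neg x))) x∈
  }

-- ℤ is the ring of rationals whose denominator is coprime to 0.
IsInt-subring : Subring IsInt
IsInt-subring = Subring-⇔ (λ {x} (⊥0 : DenominatorCoprimeTo 0 x) → 0-coprimeTo-m⇒m≡1 (Coprime.sym ⊥0))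
  (λ d≡1 → subst (λ d → Coprime d 0) (sym d≡1) (1-coprimeTo 0))
  (DenominatorCoprimeTo-subring 0)

InZM-subring : ∀ M → Subring (InZM M)
InZM-subring M = Subring-⇔ (λ {x} (⊥M : DenominatorCoprimeTo M x) → coprime⇒gcd≡1 ⊥M) gcd≡1⇒coprime
  (DenominatorCoprimeTo-subring M)

record Multiple (R : ℚ → Set) (f x : ℚ) : Set where
  constructor multiple
  field
    quotient  : ℚ
    quotient∈ : R quotient
    equality  : x ≡ f * quotient

fromΣ : ∀ {R f x} → (Σ ℚ λ k → R k × x ≡ f * k) → Multiple R f x
fromΣ (k , k∈ , eq) = multiple k k∈ eq

toΣ : ∀ {R f x} → Multiple R f x → Σ ℚ λ k → R k × x ≡ f * k
toΣ (multiple k k∈ eq) = k , k∈ , eq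

module Multiples {R : ℚ → Set} (S : Subring R) where
  open Subring S

  multiple-+ : ∀ {f x y} → Multiple R f x → Multiple R f y → Multiple R f (x + y)
  multiple-+ {f} (multiple k k∈ refl) (multiple l l∈ refl) = multiple (k + l) (+∈ k∈ l∈) (sym (ℚP.*-distribˡ-+ f k l))

  multiple-*ʳ : ∀ {f x y} → Multiple R f x → R y → Multiple R f (x * y)
  multiple-*ʳ {f} {y = y} (multiple k k∈ refl) y∈ = multiple (k * y) (*∈ k∈ y∈) (ℚP.*-assoc f k y)

  multiple-neg : ∀ {f x} → Multiple R f x → Multiple R f (- x)
  multiple-neg {f} (multiple k k∈ refl) = multiple (- k) (-∈ k∈) (ℚP.neg-distribʳ-* f k)

  multiple-minus : ∀ {f x y} → Multiple R f x → Multiple R f y → Multiple R f (x - y)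
  multiple-minus {f} x∈fR y∈fR = multiple-+ {f} x∈fR (multiple-neg {f} y∈fR)

  multiple-1 : ∀ {x} → R x → Multiple R 1ℚ x
  multiple-1 {x} x∈ = multiple x x∈ (sym (ℚP.*-identityˡ x))

  multiple-*ˡ : ∀ {f x y} → R y → Multiple R f x → Multiple R f (y * x)
  multiple-*ˡ {f} {x} {y} y∈ x∈fR = subst (Multiple R f) (ℚP.*-comm x y) (multiple-*ʳ {f} x∈fR y∈)

  det-multiple : ∀ {f a b c d} → R a → R b → R d → Multiple R f a ⊎ Multiple R f d → Multiple R f c →
                 Multiple R f (det (mat a b c d))
  det-multiple {f} a∈ b∈ d∈ (inj₁ a∈fR) c∈fR = multiple-minus {f} (multiple-*ʳ {f} a∈fR d∈) (multiple-*ˡ {f} b∈ c∈fR)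
  det-multiple {f} a∈ b∈ d∈ (inj₂ d∈fR) c∈fR = multiple-minus {f} (multiple-*ˡ {f} a∈ d∈fR) (multiple-*ˡ {f} b∈ c∈fR)

  multiple-∣ : ∀ {h n x} → (h∣n : h ℕ∣.∣ n) → Multiple R (ι (+ n)) x → Multiple R (ι (+ h)) x
  multiple-∣ {h} h∣n@(ℕ∣.divides j _) (multiple k k∈ refl) = multiple (ι (+ j) * k) (*∈ (ι∈ (+ j)) k∈)
    (trans (cong (_* k) (ι-∣-factor h∣n)) (ℚP.*-assoc (ι (+ h)) (ι (+ j)) k))

ι-∣ : ∀ {R} → Subring R → ∀ {h z} → + h ℤ∣.∣ z → Multiple R (ι (+ h)) (ι z)
ι-∣ S {h} (ℤ∣.divides T refl) = multiple (ι T) (Subring.ι∈ S T) (trans (ι-homo-* T (+ h)) (ℚP.*-comm (ι T) (ι (+ h))))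

conjBy : ℚ → Mat ℚ → Mat ℚ → Mat ℚ
conjBy δ B γ = scale δ ((B ⊗ γ) ⊗ adj B)

UpperTriangularMod : (ℚ → Set) → ℚ → Mat ℚ → Set
UpperTriangularMod R r (mat a b c d) = R a × R b × R d × Multiple R r c

-- Conditions on B = (p q ; c s) under which conjugation by δ·B preserves UpperTriangularMod R r
-- on matrices whose diagonal entries are congruent modulo h·R.
record Admissible {R : ℚ → Set} (S : Subring R) (r h δ : ℚ) (B : Mat ℚ) : Set where
  field
    unimodular : δ * det B ≡ 1ℚ
    p∈   : R (a B)
    q∈   : R (b B)
    s∈   : R (d B)
    c∈rR : Multiple R r (c B)
    δr∈  : R (δ * r)
    δpp∈ : R (δ * a B * a B)
    δss∈ : R (δ * d B * d B)
    δph∈ : R (δ * a B * h)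
    δsh∈ : R (δ * d B * h)

det-adj : ∀ B → det (adj B) ≡ det B
det-adj (mat p q r s) = solve 4 (λ p q r s → s :* p :- (:- q) :* (:- r) := p :* s :- q :* r) refl p q r s

adj-involutive : ∀ B → adj (adj B) ≡ B
adj-involutive (mat p q r s) = cong₂ (λ q r → mat p q r s) (neg-neg q) (neg-neg r)
  where
  neg-neg : ∀ x → - (- x) ≡ x
  neg-neg x = solve 1 (λ x → :- (:- x) := x) refl x

adj-admissible : ∀ {R} {S : Subring R} {r h δ B} → Admissible S r h δ B → Admissible S r h δ (adj B)
adj-admissible {S = S} {r} {δ = δ} {B = B} adm = record
  { unimodular = trans (cong (δ *_) (det-adj B)) unimodular
  ; p∈ = s∈ ; q∈ = -∈ q∈ ; s∈ = p∈ ; c∈rR = multiple-neg {r} c∈rR ; δr∈ = δr∈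
  ; δpp∈ = δss∈ ; δss∈ = δpp∈ ; δph∈ = δsh∈ ; δsh∈ = δph∈
  }
  where open Subring S; open Multiples S; open Admissible adm

det-conjBy : ∀ δ B γ → det (conjBy δ B γ) ≡ (δ * det B) * (δ * det B) * det γ
det-conjBy δ (mat p q r s) (mat a b c d) = solve 9 (λ δ p q r s a b c d →
    (δ :* ((p :* a :+ q :* c) :* s :+ (p :* b :+ q :* d) :* (:- r))) :* (δ :* ((r :* a :+ s :* c) :* (:- q) :+ (r :* b :+ s :* d) :* p))
    :- (δ :* ((p :* a :+ q :* c) :* (:- q) :+ (p :* b :+ q :* d) :* p)) :* (δ :* ((r :* a :+ s :* c) :* s :+ (r :* b :+ s :* d) :* (:- r)))
  := (δ :* (p :* s :- q :* r)) :* (δ :* (p :* s :- q :* r)) :* (a :* d :- b :* c)) refl δ p q r s a b c d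

conjBy-det : ∀ δ B → δ * det B ≡ 1ℚ → ∀ γ → det (conjBy δ B γ) ≡ det γ
conjBy-det δ B unimodular γ = begin
  det (conjBy δ B γ)                    ≡⟨ det-conjBy δ B γ ⟩
  (δ * det B) * (δ * det B) * det γ     ≡⟨ cong (λ w → w * w * det γ) unimodular ⟩
  1ℚ * 1ℚ * det γ                       ≡⟨ cong (_* det γ) (ℚP.*-identityˡ 1ℚ) ⟩
  1ℚ * det γ                            ≡⟨ ℚP.*-identityˡ (det γ) ⟩
  det γ                                 ∎
  where open ≡-Reasoning

module ConjugateEntries (δ p q r β s a b k d : ℚ) where
  B = mat p q (r * β) s
  γ = mat a b (r * k) d
  W = δ * det B
  e = δ * r
  X = β * q * (a - d) - β * p * b + q * s * k

  a-entry : Mat.a (conjBy δ B γ) ≡ a * W + e * X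
  a-entry = solve 10 (λ δ p q r β s a b k d →
    δ :* ((p :* a :+ q :* (r :* k)) :* s :+ (p :* b :+ q :* d) :* (:- (r :* β)))
      := a :* (δ :* (p :* s :- q :* (r :* β))) :+ (δ :* r) :* (β :* q :* (a :- d) :- β :* p :* b :+ q :* s :* k))
    refl δ p q r β s a b k d

  d-entry : Mat.d (conjBy δ B γ) ≡ d * W - e * X
  d-entry = solve 10 (λ δ p q r β s a b k d →
    δ :* (((r :* β) :* a :+ s :* (r :* k)) :* (:- q) :+ ((r :* β) :* b :+ s :* d) :* p)
      := d :* (δ :* (p :* s :- q :* (r :* β))) :- (δ :* r) :* (β :* q :* (a :- d) :- β :* p :* b :+ q :* s :* k))
    refl δ p q r β s a b k d

  b-entry : Mat.b (conjBy δ B γ) ≡ - (q * (δ * p * (a - d))) - q * q * k * e + δ * p * p * b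
  b-entry = solve 10 (λ δ p q r β s a b k d →
    δ :* ((p :* a :+ q :* (r :* k)) :* (:- q) :+ (p :* b :+ q :* d) :* p)
      := :- (q :* (δ :* p :* (a :- d))) :- q :* q :* k :* (δ :* r) :+ δ :* p :* p :* b)
    refl δ p q r β s a b k d

  c-entry : Mat.c (conjBy δ B γ) ≡ r * (β * (δ * s * (a - d)) + δ * s * s * k - β * β * e * b)
  c-entry = solve 10 (λ δ p q r β s a b k d →
    δ :* (((r :* β) :* a :+ s :* (r :* k)) :* s :+ ((r :* β) :* b :+ s :* d) :* (:- (r :* β)))
      := r :* (β :* (δ :* s :* (a :- d)) :+ δ :* s :* s :* k :- β :* β :* (δ :* r) :* b))
    refl δ p q r β s a b k d

  diagonal : Mat.a (conjBy δ B γ) - Mat.d (conjBy δ B γ)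
           ≡ (a - d) * (W + e * (β * q) + e * (β * q)) + e * p * (- (β * b) - β * b) + e * s * (q * k + q * k)
  diagonal = solve 10 (λ δ p q r β s a b k d →
    δ :* ((p :* a :+ q :* (r :* k)) :* s :+ (p :* b :+ q :* d) :* (:- (r :* β)))
      :- δ :* (((r :* β) :* a :+ s :* (r :* k)) :* (:- q) :+ ((r :* β) :* b :+ s :* d) :* p)
      := (a :- d) :* (δ :* (p :* s :- q :* (r :* β)) :+ (δ :* r) :* (β :* q) :+ (δ :* r) :* (β :* q))
         :+ (δ :* r) :* p :* (:- (β :* b) :- β :* b) :+ (δ :* r) :* s :* (q :* k :+ q :* k))
    refl δ p q r β s a b k d

module Conjugation {R : ℚ → Set} (S : Subring R) where
  open Subring S
  open Multiples S

  conjBy-upperTriangular : ∀ {r h δ B γ} → Admissible S r h δ B → UpperTriangularMod R r γ →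
                           Multiple R h (a γ - d γ) → UpperTriangularMod R r (conjBy δ B γ)
  conjBy-upperTriangular {r} {h} {δ} {mat p q _ s} {mat a b _ d} adm (a∈ , b∈ , d∈ , multiple k k∈ refl) (multiple t t∈ a-d≡ht)
    with Admissible.c∈rR adm
  ... | multiple β β∈ refl =
      ∈-resp a-entry (+∈ (*∈ a∈ W∈) (*∈ δr∈ X∈))
    , ∈-resp b-entry (+∈ (∸∈ (-∈ (*∈ q∈ (δ[a-d]∈ δph∈))) (*∈ (*∈ (*∈ q∈ q∈) k∈) δr∈)) (*∈ δpp∈ b∈))
    , ∈-resp d-entry (∸∈ (*∈ d∈ W∈) (*∈ δr∈ X∈))
    , multiple _ (+∈ (+∈ (*∈ β∈ (δ[a-d]∈ δsh∈)) (*∈ δss∈ k∈)) (-∈ (*∈ (*∈ (*∈ β∈ β∈) δr∈) b∈))) c-entry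
    where
    open Admissible adm
    open ConjugateEntries δ p q r β s a b k d

    W∈ : R W
    W∈ = ∈-resp unimodular 1∈

    X∈ : R X
    X∈ = +∈ (∸∈ (*∈ (*∈ β∈ q∈) (∸∈ a∈ d∈)) (*∈ (*∈ β∈ p∈) b∈)) (*∈ (*∈ q∈ s∈) k∈)

    δ[a-d]∈ : ∀ {x} → R (δ * x * h) → R (δ * x * (a - d))
    δ[a-d]∈ {x} δxh∈ = ∈-resp (trans (cong (δ * x *_) a-d≡ht) (sym (ℚP.*-assoc (δ * x) h t))) (*∈ δxh∈ t∈)

  conjBy-diagonal : ∀ {f r h δ B γ} → Admissible S r h δ B → UpperTriangularMod R r γ →
                    Multiple R f (δ * r * a B) → Multiple R f (δ * r * d B) →
                    Multiple R f (a γ - d γ) → Multiple R f (a (conjBy δ B γ) - d (conjBy δ B γ))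
  conjBy-diagonal {f} {r} {h} {δ} {mat p q _ s} {mat a b _ d} adm (a∈ , b∈ , d∈ , multiple k k∈ refl) δrp∈fR δrs∈fR a-d∈fR
    with Admissible.c∈rR adm
  ... | multiple β β∈ refl = subst (Multiple R f) (sym diagonal)
        (multiple-+ {f} (multiple-+ {f} (multiple-*ʳ {f} a-d∈fR W′∈) (multiple-*ʳ {f} δrp∈fR Y∈))
                    (multiple-*ʳ {f} δrs∈fR Z∈))
    where
    open Admissible adm
    open ConjugateEntries δ p q r β s a b k d

    W′∈ : R (W + e * (β * q) + e * (β * q))
    W′∈ = +∈ (+∈ (∈-resp unimodular 1∈) (*∈ δr∈ (*∈ β∈ q∈))) (*∈ δr∈ (*∈ β∈ q∈))

    Y∈ : R (- (β * b) - β * b)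
    Y∈ = ∸∈ (-∈ (*∈ β∈ b∈)) (*∈ β∈ b∈)

    Z∈ : R (q * k + q * k)
    Z∈ = +∈ (*∈ q∈ k∈) (*∈ q∈ k∈)

InvolutiveUnits : ℕ → Set
InvolutiveUnits h = ∀ {i} → i < h → ∀ {j} → j < h → + h ℤ∣.∣ + i ℤ.* + j ℤ.- 1ℤ → i ≡ j

private
  residue-identity : ∀ A r x h → A ≡ r ℤ.+ x ℤ.* h → A ℤ.- r ≡ x ℤ.* h
  residue-identity _ r x h refl = lemma r x h
    where
    lemma : ∀ r x h → r ℤ.+ x ℤ.* h ℤ.- r ≡ x ℤ.* h
    lemma = solve-∀

  product-of-residues : ∀ A D i j → i ℤ.* j ℤ.- 1ℤ ≡ (A ℤ.* D ℤ.- 1ℤ) ℤ.- ((A ℤ.- i) ℤ.* D ℤ.+ i ℤ.* (D ℤ.- j))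
  product-of-residues = solve-∀

  difference-of-residues : ∀ A D i → A ℤ.- D ≡ (A ℤ.- i) ℤ.- (D ℤ.- i)
  difference-of-residues = solve-∀

∣-minus-%ℕ : ∀ h .{{_ : NonZero h}} A → + h ℤ∣.∣ A ℤ.- + (A %ℕ h)
∣-minus-%ℕ h A = ℤ∣.divides (A /ℕ h) (residue-identity A (+ (A %ℕ h)) (A /ℕ h) (+ h) (a≡a%ℕn+[a/ℕn]*n A h))

∣ad-1⇒∣a-d : ∀ {h} .{{_ : NonZero h}} → InvolutiveUnits h →
             ∀ {A D} → + h ℤ∣.∣ A ℤ.* D ℤ.- 1ℤ → + h ℤ∣.∣ A ℤ.- D
∣ad-1⇒∣a-d {h} involutive {A} {D} h∣AD-1 = subst (+ h ℤ∣.∣_) (sym (difference-of-residues A D (+ i)))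
  (ℤ∣.∣m∣n⇒∣m-n (∣-minus-%ℕ h A) (subst (λ j → + h ℤ∣.∣ D ℤ.- + j) (sym i≡j) (∣-minus-%ℕ h D)))
  where
  i = A %ℕ h
  j = D %ℕ h
  h∣ij-1 : + h ℤ∣.∣ + i ℤ.* + j ℤ.- 1ℤ
  h∣ij-1 = subst (+ h ℤ∣.∣_) (sym (product-of-residues A D (+ i) (+ j)))
    (ℤ∣.∣m∣n⇒∣m-n h∣AD-1
      (ℤ∣.∣m∣n⇒∣m+n (ℤ∣.∣m⇒∣m*n D (∣-minus-%ℕ h A)) (ℤ∣.∣n⇒∣m*n (+ i) (∣-minus-%ℕ h D))))
  i≡j : i ≡ j
  i≡j = involutive (n%ℕd<d A h) (n%ℕd<d D h) h∣ij-1

∣-parity : ∀ N → + 2 ℤ∣.∣ N ⊎ + 2 ℤ∣.∣ N ℤ.- 1ℤ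
∣-parity N with N %ℕ 2 | n%ℕd<d N 2 | ∣-minus-%ℕ 2 N
... | 0 | _ | 2∣N-0 = inj₁ (subst (+ 2 ℤ∣.∣_) (ℤP.+-identityʳ N) 2∣N-0)
... | 1 | _ | 2∣N-1 = inj₂ 2∣N-1
... | suc (suc _) | ℕ.s≤s (ℕ.s≤s ()) | _

private
  x-y≡1⇒x-1≡y : ∀ x y → x ℤ.- y ≡ 1ℤ → x ℤ.- 1ℤ ≡ y
  x-y≡1⇒x-1≡y x y x-y≡1 = trans (cong (λ t → x ℤ.- t) (sym x-y≡1)) (lemma x y)
    where
    lemma : ∀ x y → x ℤ.- (x ℤ.- y) ≡ y
    lemma = solve-∀

InΓ₀-diagonal : ∀ {M h} .{{_ : NonZero h}} → InvolutiveUnits h → h ℕ∣.∣ M →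
                ∀ γ → InΓ₀ M γ → Multiple IsInt (ι (+ h)) (a γ - d γ)
InΓ₀-diagonal {M} {h} involutive h∣M (mat a b _ d) (a∈ , b∈ , d∈ , (k , k∈ , refl) , det≡1) =
  subst (Multiple IsInt (ι (+ h))) (sym a-d≡) (ι-∣ IsInt-subring (∣ad-1⇒∣a-d involutive {A} {D} h∣AD-1))
  where
  A = ↥ a
  B = ↥ b
  D = ↥ d
  K = ↥ k
  a≡ = IsInt⇒≡ι↥ {a} a∈
  d≡ = IsInt⇒≡ι↥ {d} d∈
  det≡ : det (mat a b (ι (+ M) * k) d) ≡ ι (A ℤ.* D ℤ.- B ℤ.* (+ M ℤ.* K))
  det≡ = begin
    a * d - b * (ι (+ M) * k)
      ≡⟨ cong₂ _-_ (cong₂ _*_ a≡ d≡) (cong₂ _*_ (IsInt⇒≡ι↥ {b} b∈) (cong (ι (+ M) *_) (IsInt⇒≡ι↥ {k} k∈))) ⟩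
    ι A * ι D - ι B * (ι (+ M) * ι K)
      ≡⟨ cong₂ _-_ (ι-homo-* A D) (trans (ι-homo-* B _) (cong (ι B *_) (ι-homo-* (+ M) K))) ⟨
    ι (A ℤ.* D) - ι (B ℤ.* (+ M ℤ.* K))
      ≡⟨ ι-homo-minus (A ℤ.* D) (B ℤ.* (+ M ℤ.* K)) ⟨
    ι (A ℤ.* D ℤ.- B ℤ.* (+ M ℤ.* K)) ∎
    where open ≡-Reasoning
  h∣AD-1 : + h ℤ∣.∣ A ℤ.* D ℤ.- 1ℤ
  h∣AD-1 = subst (+ h ℤ∣.∣_) (sym (x-y≡1⇒x-1≡y (A ℤ.* D) (B ℤ.* (+ M ℤ.* K)) (ι-injective (trans (sym det≡) det≡1))))
    (ℤ∣.∣n⇒∣m*n B (ℤ∣.∣m⇒∣m*n K (ℤ∣.∣ᵤ⇒∣ {+ h} {+ M} h∣M)))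
  a-d≡ : a - d ≡ ι (A ℤ.- D)
  a-d≡ = trans (cong₂ _-_ a≡ d≡) (sym (ι-homo-minus A D))

module Parity {M : ℕ} (2∣M : 2 ℕ∣.∣ M) where
  private
    S = InZM-subring M
    open Subring S
    open Multiples S
    2R : ℚ → Set
    2R = Multiple (InZM M) (ι (+ 2))

  odd-denominator : ∀ {x} → InZM M x → + 2 ℤ∣.∣ + ↧ₙ x ℤ.- 1ℤ
  odd-denominator {x} x∈ with ∣-parity (+ ↧ₙ x)
  ... | inj₁ 2∣n   = contradiction (gcd≡1⇒coprime x∈ (ℤ∣.∣⇒∣ᵤ 2∣n , 2∣M)) λ ()
  ... | inj₂ 2∣n-1 = 2∣n-1

  minus-numerator : ∀ {x} → InZM M x → 2R (x - ι (↥ x))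
  minus-numerator {x} x∈ with odd-denominator {x} x∈
  ... | ℤ∣.divides Z n-1≡Z*2 = multiple (- (x * ι Z)) (-∈ {x * ι Z} (*∈ {x} x∈ (ι∈ Z))) (begin
    x - ι (↥ x)                    ≡⟨ cong (λ t → x - t) (*-↧≡↥ x) ⟨
    x - x * ι (+ ↧ₙ x)             ≡⟨ solve 2 (λ x y → x :- x :* y := :- (x :* (y :- con 1ℚ))) refl x (ι (+ ↧ₙ x)) ⟩
    - (x * (ι (+ ↧ₙ x) - 1ℚ))      ≡⟨ cong (λ t → - (x * t)) (trans (sym (ι-homo-minus (+ ↧ₙ x) 1ℤ)) (cong ι n-1≡Z*2)) ⟩
    - (x * ι (Z ℤ.* + 2))          ≡⟨ cong (λ t → - (x * t)) (ι-homo-* Z (+ 2)) ⟩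
    - (x * (ι Z * ι (+ 2)))        ≡⟨ solve 3 (λ x z t → :- (x :* (z :* t)) := t :* (:- (x :* z))) refl x (ι Z) (ι (+ 2)) ⟩
    ι (+ 2) * - (x * ι Z)          ∎)
    where open ≡-Reasoning

  parity : ∀ {x} → InZM M x → 2R x ⊎ 2R (x - 1ℚ)
  parity {x} x∈ with ∣-parity (↥ x)
  ... | inj₁ 2∣N = inj₁ (subst 2R (solve 2 (λ x y → x :- y :+ y := x) refl x (ι (↥ x)))
                          (multiple-+ {ι (+ 2)} (minus-numerator {x} x∈) (ι-∣ S 2∣N)))
  ... | inj₂ 2∣N-1 = inj₂ (subst 2R (trans (cong (λ t → x - ι (↥ x) + t) (ι-homo-minus (↥ x) 1ℤ))
                                           (solve 2 (λ x y → x :- y :+ (y :- con 1ℚ) := x :- con 1ℚ) refl x (ι (↥ x))))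
                            (multiple-+ {ι (+ 2)} (minus-numerator {x} x∈) (ι-∣ S 2∣N-1)))

  ½∉ : ¬ 2R 1ℚ
  ½∉ (multiple k k∈ 1≡2k) = contradiction (gcd≡1⇒coprime (subst (InZM M) k≡½ k∈) (ℕ∣.∣-refl , 2∣M)) λ ()
    where
    k≡½ : k ≡ ½
    k≡½ = begin
      k                    ≡⟨ ℚP.*-identityˡ k ⟨
      (½ * ι (+ 2)) * k    ≡⟨ ℚP.*-assoc ½ (ι (+ 2)) k ⟩
      ½ * (ι (+ 2) * k)    ≡⟨ cong (½ *_) 1≡2k ⟨
      ½ * 1ℚ               ≡⟨ ℚP.*-identityʳ ½ ⟩
      ½                    ∎
      where open ≡-Reasoning

  InG₀-diagonal : ∀ γ → InG₀ M γ → 2R (a γ - d γ)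
  InG₀-diagonal (mat a b c d) (a∈ , b∈ , d∈ , c∈MR , _ , e , e∈ , det*e≡1) = odd-diagonal (parity a∈) (parity d∈)
    where
    1∈2R : 2R a ⊎ 2R d → 2R 1ℚ
    1∈2R a∨d∈2R = subst 2R det*e≡1
      (multiple-*ʳ {ι (+ 2)} (det-multiple {a = a} {b} {c} {d} a∈ b∈ d∈ a∨d∈2R (multiple-∣ 2∣M (fromΣ c∈MR))) e∈)

    odd-diagonal : 2R a ⊎ 2R (a - 1ℚ) → 2R d ⊎ 2R (d - 1ℚ) → 2R (a - d)
    odd-diagonal (inj₁ a∈2R) _ = contradiction (1∈2R (inj₁ a∈2R)) ½∉
    odd-diagonal (inj₂ _) (inj₁ d∈2R) = contradiction (1∈2R (inj₂ d∈2R)) ½∉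
    odd-diagonal (inj₂ a-1∈2R) (inj₂ d-1∈2R) = subst 2R (solve 2 (λ a d → (a :- con 1ℚ) :- (d :- con 1ℚ) := a :- d) refl a d)
      (multiple-minus {ι (+ 2)} a-1∈2R d-1∈2R)

InΓ₀-conjBy : ∀ {M h δ B} .{{_ : NonZero h}} → Admissible IsInt-subring (ι (+ M)) (ι (+ h)) δ B →
              InvolutiveUnits h → h ℕ∣.∣ M → ∀ γ → InΓ₀ M γ → InΓ₀ M (conjBy δ B γ)
InΓ₀-conjBy {δ = δ} {B} adm involutive h∣M γ γ∈@(a∈ , b∈ , d∈ , c∈ , det≡1) =
  let a′∈ , b′∈ , d′∈ , c′∈ = conjBy-upperTriangular adm (a∈ , b∈ , d∈ , fromΣ c∈) (InΓ₀-diagonal involutive h∣M γ γ∈)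
  in  a′∈ , b′∈ , d′∈ , toΣ c′∈ , trans (conjBy-det δ B (Admissible.unimodular adm) γ) det≡1
  where open Conjugation IsInt-subring

InΓ₀⁽⁾-conjBy : ∀ {f M h δ B} → Admissible IsInt-subring (ι (+ M)) (ι (+ h)) δ B → h ℕ∣.∣ f →
                Multiple IsInt (ι (+ f)) (δ * ι (+ M) * a B) → Multiple IsInt (ι (+ f)) (δ * ι (+ M) * d B) →
                ∀ γ → InΓ₀⁽ f ⁾ M γ → InΓ₀⁽ f ⁾ M (conjBy δ B γ)
InΓ₀⁽⁾-conjBy {f} {h = h} {δ} {B} adm h∣f δMp∈fℤ δMs∈fℤ γ ((a∈ , b∈ , d∈ , c∈ , det≡1) , a-d∈fℤ) =
  let a′∈ , b′∈ , d′∈ , c′∈ = conjBy-upperTriangular adm upper a-d∈hℤ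
  in  (a′∈ , b′∈ , d′∈ , toΣ c′∈ , trans (conjBy-det δ B (Admissible.unimodular adm) γ) det≡1) ,
      toΣ (conjBy-diagonal adm upper δMp∈fℤ δMs∈fℤ (fromΣ a-d∈fℤ))
  where
  open Conjugation IsInt-subring
  upper = (a∈ , b∈ , d∈ , fromΣ c∈)
  a-d∈hℤ = Multiples.multiple-∣ IsInt-subring h∣f (fromΣ a-d∈fℤ)

InG₀-conjBy : ∀ {M h δ B} → Admissible (InZM-subring M) (ι (+ M)) (ι (+ h)) δ B →
              h ≡ 1 ⊎ h ≡ 2 → h ℕ∣.∣ M → ∀ γ → InG₀ M γ → InG₀ M (conjBy δ B γ)
InG₀-conjBy {M} {h} {δ} {B} adm h≡1∨2 h∣M γ γ∈@(a∈ , b∈ , d∈ , c∈ , det∈ , e , e∈ , det*e≡1) =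
  let a′∈ , b′∈ , d′∈ , c′∈ = conjBy-upperTriangular adm (a∈ , b∈ , d∈ , fromΣ c∈) (diagonal h≡1∨2)
  in  a′∈ , b′∈ , d′∈ , toΣ c′∈ , subst (InZM M) (sym det≡) det∈ , e , e∈ , trans (cong (_* e) det≡) det*e≡1
  where
  open Conjugation (InZM-subring M)
  det≡ : det (conjBy δ B γ) ≡ det γ
  det≡ = conjBy-det δ B (Admissible.unimodular adm) γ
  diagonal : h ≡ 1 ⊎ h ≡ 2 → Multiple (InZM M) (ι (+ h)) (a γ - d γ)
  diagonal (inj₁ h≡1) = subst (λ h → Multiple (InZM M) (ι (+ h)) (a γ - d γ)) (sym h≡1)
    (Multiples.multiple-1 (InZM-subring M) (Subring.∸∈ (InZM-subring M) {a γ} a∈ d∈))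
  diagonal (inj₂ h≡2) = subst (λ h → Multiple (InZM M) (ι (+ h)) (a γ - d γ)) (sym h≡2)
    (Parity.InG₀-diagonal (subst (ℕ∣._∣ M) h≡2 h∣M) γ γ∈)

gcd-nonZero : ∀ M m .{{_ : NonZero M}} → NonZero (gcd M m)
gcd-nonZero M m = ℕ.≢-nonZero (gcd[m,n]≢0 M m (inj₁ (ℕ.≢-nonZero⁻¹ M)))

-- (M, m²) / (M, m); the value at M = 0 is junk.
alModulus : ℕ → ℕ → ℕ
alModulus zero      _ = 0
alModulus M@(suc _) m = (Dval M m / gcd M m) {{gcd-nonZero M m}}

gcd∣Dval : ∀ M m → gcd M m ℕ∣.∣ Dval M m
gcd∣Dval M m = gcd-greatest (gcd[m,n]∣m M m) (ℕ∣.∣m⇒∣m*n m (gcd[m,n]∣n M m))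

gcd*alModulus : ∀ M m .{{_ : NonZero M}} → gcd M m ℕ.* alModulus M m ≡ Dval M m
gcd*alModulus M@(suc _) m = m*[n/m]≡n {{gcd-nonZero M m}} (gcd∣Dval M m)

-- (M, m²) divides M·(M, m) and m·(M, m), hence also (M, m)² = ((M, m)·M, (M, m)·m).
Dval∣gcd² : ∀ M m → Dval M m ℕ∣.∣ gcd M m ℕ.* gcd M m
Dval∣gcd² M m = subst (Dval M m ℕ∣.∣_) (sym (c*gcd[m,n]≡gcd[cm,cn] g M m))
  (gcd-greatest (ℕ∣.∣n⇒∣m*n g D∣M) (subst (Dval M m ℕ∣.∣_) (ℕP.*-comm m g) D∣m*g))
  where
  g = gcd M m
  D∣M = gcd[m,n]∣m M (m ℕ.* m)
  D∣m*g : Dval M m ℕ∣.∣ m ℕ.* g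
  D∣m*g = subst (Dval M m ℕ∣.∣_) (sym (c*gcd[m,n]≡gcd[cm,cn] m M m))
    (gcd-greatest (ℕ∣.∣n⇒∣m*n m D∣M) (gcd[m,n]∣n M (m ℕ.* m)))

module AtkinLehner (M m : ℕ) .{{_ : NonZero M}} (u v : ℤ) (al : ALCond M m u v) where
  g = gcd M m
  D = Dval M m
  h = alModulus M m
  δ = recipℕ D
  A = ALmat M m u v

  instance
    D-nonZero : NonZero D
    D-nonZero = ℕ.≢-nonZero (gcd[m,n]≢0 M (m ℕ.* m) (inj₁ (ℕ.≢-nonZero⁻¹ M)))

  D∣M : D ℕ∣.∣ M
  D∣M = gcd[m,n]∣m M (m ℕ.* m)

  h∣M : h ℕ∣.∣ M
  h∣M = ℕ∣.∣-trans (ℕ∣.divides g (sym (gcd*alModulus M m))) D∣M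

  instance
    h-nonZero : NonZero h
    h-nonZero = ℕ.≢-nonZero λ h≡0 → ℕ.≢-nonZero⁻¹ D
      (trans (sym (gcd*alModulus M m)) (trans (cong (g ℕ.*_) h≡0) (ℕP.*-zeroʳ g)))

  D∣m*h : D ℕ∣.∣ m ℕ.* h
  D∣m*h = subst (ℕ∣._∣ m ℕ.* h) (gcd*alModulus M m) (ℕ∣.*-monoˡ-∣ h (gcd[m,n]∣n M m))

  D∣g*h : D ℕ∣.∣ g ℕ.* h
  D∣g*h = ℕ∣.∣-reflexive (sym (gcd*alModulus M m))

  det-A : det A ≡ ι (+ D)
  det-A = begin
    ι (+ m) * ι (+ g ℤ.* v) - ι u * ι (+ M)   ≡⟨ cong₂ _-_ (ι-homo-* (+ m) (+ g ℤ.* v)) (ι-homo-* u (+ M)) ⟨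
    ι (+ m ℤ.* (+ g ℤ.* v)) - ι (u ℤ.* + M)     ≡⟨ ι-homo-minus (+ m ℤ.* (+ g ℤ.* v)) (u ℤ.* + M) ⟨
    ι (+ m ℤ.* (+ g ℤ.* v) ℤ.- u ℤ.* + M)       ≡⟨ cong ι (rearrange (+ m) (+ g) v u (+ M)) ⟩
    ι (+ g ℤ.* + m ℤ.* v ℤ.- + M ℤ.* u)         ≡⟨ cong ι al ⟩
    ι (+ D)                                     ∎
    where
    open ≡-Reasoning
    rearrange : ∀ m g v u M → m ℤ.* (g ℤ.* v) ℤ.- u ℤ.* M ≡ g ℤ.* m ℤ.* v ℤ.- M ℤ.* u
    rearrange = solve-∀

  ι-gv : ι (+ g ℤ.* v) ≡ ι (+ g) * ι v
  ι-gv = ι-homo-* (+ g) v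

  admissible : ∀ {R} (S : Subring R) → Admissible S (ι (+ M)) (ι (+ h)) δ A
  admissible {R} S = record
    { unimodular = trans (cong (δ *_) det-A) (recipℕ-inverse D)
    ; p∈   = ι∈ (+ m)
    ; q∈   = ι∈ u
    ; s∈   = ι∈ (+ g ℤ.* v)
    ; c∈rR = multiple 1ℚ 1∈ (sym (ℚP.*-identityʳ (ι (+ M))))
    ; δr∈  = ∈-resp (recipℕ-cancel D∣M) (ι∈ (+ ℕ∣.quotient D∣M))
    ; δpp∈ = δ-integral m m (gcd[m,n]∣n M (m ℕ.* m))
    ; δss∈ = ∈-resp (trans (cong (λ s → δ * s * s) ι-gv)
                       (solve 3 (λ δ g v → δ :* (g :* v) :* (g :* v) := δ :* g :* g :* (v :* v)) refl δ (ι (+ g)) (ι v)))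
                    (*∈ (δ-integral g g (Dval∣gcd² M m)) (*∈ (ι∈ v) (ι∈ v)))
    ; δph∈ = δ-integral m h D∣m*h
    ; δsh∈ = ∈-resp (trans (cong (λ s → δ * s * ι (+ h)) ι-gv)
                       (solve 4 (λ δ g v h → δ :* (g :* v) :* h := δ :* g :* h :* v) refl δ (ι (+ g)) (ι v) (ι (+ h))))
                    (*∈ (δ-integral g h D∣g*h) (ι∈ v))
    }
    where
    open Subring S

    δ-integral : ∀ x y → D ℕ∣.∣ x ℕ.* y → R (δ * ι (+ x) * ι (+ y))
    δ-integral x y D∣xy = ∈-resp (recipℕ-cancel-* x y D∣xy) (ι∈ (+ ℕ∣.quotient D∣xy))

  conjW⁻¹≡conjBy-adj : ∀ γ → conjW⁻¹ M m u v γ ≡ conjBy δ (adj A) γ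
  conjW⁻¹≡conjBy-adj γ = cong (λ B → scale δ ((adj A ⊗ γ) ⊗ B)) (sym (adj-involutive A))

  normalizer : ∀ {H : Mat ℚ → Set} (P : Mat ℚ → Set) → (∀ {B} → P B → P (adj B)) → P A →
               (∀ {B} → P B → ∀ γ → H γ → H (conjBy δ B γ)) → InNormalizer H M m u v
  normalizer {H} P P-adj P-A closed =
    closed P-A , λ γ γ∈ → subst H (sym (conjW⁻¹≡conjBy-adj γ)) (closed (P-adj P-A) γ γ∈)

  normalizes-Γ₀ : InvolutiveUnits h → InNormalizer (InΓ₀ M) M m u v
  normalizes-Γ₀ involutive = normalizer (Admissible IsInt-subring (ι (+ M)) (ι (+ h)) δ)
    adj-admissible (admissible IsInt-subring) (λ adm → InΓ₀-conjBy adm involutive h∣M)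

  normalizes-G₀ : h ≡ 1 ⊎ h ≡ 2 → InNormalizer (InG₀ M) M m u v
  normalizes-G₀ h≡1∨2 = normalizer (Admissible (InZM-subring M) (ι (+ M)) (ι (+ h)) δ)
    adj-admissible (admissible (InZM-subring M)) (λ adm → InG₀-conjBy adm h≡1∨2 h∣M)

  normalizes-Γ₀⁽⁾ : ∀ f → h ℕ∣.∣ f → D ℕ.* f ℕ∣.∣ M ℕ.* m → D ℕ.* f ℕ∣.∣ M ℕ.* g →
                    InNormalizer (InΓ₀⁽ f ⁾ M) M m u v
  normalizes-Γ₀⁽⁾ f h∣f Df∣Mm Df∣Mg = normalizer P
    (λ (adm , δMp∈fℤ , δMs∈fℤ) → adj-admissible adm , δMs∈fℤ , δMp∈fℤ)
    (admissible IsInt-subring , δM-multiple Df∣Mm , δMs∈fℤ)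
    (λ (adm , δMp∈fℤ , δMs∈fℤ) → InΓ₀⁽⁾-conjBy {f} {M} {h} adm h∣f δMp∈fℤ δMs∈fℤ)
    where
    P : Mat ℚ → Set
    P B = Admissible IsInt-subring (ι (+ M)) (ι (+ h)) δ B ×
          Multiple IsInt (ι (+ f)) (δ * ι (+ M) * a B) × Multiple IsInt (ι (+ f)) (δ * ι (+ M) * d B)

    δM-multiple : ∀ {x} → D ℕ.* f ℕ∣.∣ M ℕ.* x → Multiple IsInt (ι (+ f)) (δ * ι (+ M) * ι (+ x))
    δM-multiple {x} (ℕ∣.divides q Mx≡q*Df) =
      multiple (ι (+ q)) (IsInt-ι (+ q)) (trans (recipℕ-cancel-* M x D∣Mx) (ι-∣-factor (ℕ∣.divides q refl)))
      where
      D∣Mx : D ℕ∣.∣ M ℕ.* x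
      D∣Mx = ℕ∣.divides (q ℕ.* f) (trans Mx≡q*Df (reassociate q D f))
        where
        reassociate : ∀ q D f → q ℕ.* (D ℕ.* f) ≡ q ℕ.* f ℕ.* D
        reassociate = ℕSolver.solve-∀

    δMs∈fℤ : Multiple IsInt (ι (+ f)) (δ * ι (+ M) * ι (+ g ℤ.* v))
    δMs∈fℤ = subst (Multiple IsInt (ι (+ f)))
      (sym (trans (cong (δ * ι (+ M) *_) ι-gv) (sym (ℚP.*-assoc (δ * ι (+ M)) (ι (+ g)) (ι v)))))
      (Multiples.multiple-*ʳ IsInt-subring {ι (+ f)} (δM-multiple Df∣Mg) (IsInt-ι v))

CuspConditions : ℕ → ℕ → Set
CuspConditions M m =
  ((M , cusp M m) ∈ exceptions₁ ⊎ InvolutiveUnits (alModulus M m)) ×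
  ((M , cusp M m) ∈ exceptions₂ ⊎ alModulus M m ≡ 1 ⊎ alModulus M m ≡ 2)

cuspConditions? : ∀ M m → Dec (CuspConditions M m)
cuspConditions? M m =
  ((M , cusp M m) ∈? exceptions₁ ⊎-dec involutiveUnits? (alModulus M m)) ×-dec
  ((M , cusp M m) ∈? exceptions₂ ⊎-dec alModulus M m ℕ.≟ 1 ⊎-dec alModulus M m ℕ.≟ 2)
  where
  _∈?_ = DecMembership._∈?_ (≡-dec ℕ._≟_ ℚ._≟_)
  involutiveUnits? : ∀ h → Dec (InvolutiveUnits h)
  involutiveUnits? h = ℕP.allUpTo? (λ i → ℕP.allUpTo? (λ j → (+ h ℤ∣.∣? + i ℤ.* + j ℤ.- 1ℤ) →-dec (i ℕ.≟ j)) h) h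

genusZeroConditions : All (λ M → ∀ {m} → m < M → CuspConditions M m) genusZeroLevels
genusZeroConditions = from-yes (All.all? (λ M → ℕP.allUpTo? (cuspConditions? M) M) genusZeroLevels)

Level25Conditions : ℕ → Set
Level25Conditions m =
  alModulus 25 m ℕ∣.∣ 5 × Dval 25 m ℕ.* 5 ℕ∣.∣ 25 ℕ.* m × Dval 25 m ℕ.* 5 ℕ∣.∣ 25 ℕ.* gcd 25 m

level25Conditions : ∀ {m} → m < 25 → Level25Conditions m
level25Conditions = from-yes (ℕP.allUpTo? (λ m →
  alModulus 25 m ℕ∣.∣? 5 ×-dec Dval 25 m ℕ.* 5 ℕ∣.∣? 25 ℕ.* m ×-dec Dval 25 m ℕ.* 5 ℕ∣.∣? 25 ℕ.* gcd 25 m) 25)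

normalizes-Γ₀⁽⁵⁾⁽25⁾ : ∀ {M m} u v → M ≡ 25 → m < M → ALCond M m u v → InNormalizer (InΓ₀⁽ 5 ⁾ 25) M m u v
normalizes-Γ₀⁽⁵⁾⁽25⁾ {m = m} u v refl m<25 al =
  let h∣5 , D5∣Mm , D5∣Mg = level25Conditions m<25
  in  AtkinLehner.normalizes-Γ₀⁽⁾ 25 m u v al 5 h∣5 D5∣Mm D5∣Mg

proposition5p10 :
    (M m : ℕ) → M ∈ genusZeroLevels → m < M →
    (u v : ℤ) → ALCond M m u v →
    ((M , cusp M m) ∉ exceptions₁ → InNormalizer (InΓ₀ M) M m u v) ×
    ((M , cusp M m) ∉ exceptions₂ → InNormalizer (InG₀ M) M m u v) ×
    (M ≡ 25 → cusp M m ∈ cusps25 → InNormalizer (InΓ₀⁽ 5 ⁾ 25) M m u v)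
proposition5p10 M m M∈ m<M u v al =
    (λ M∉ → normalizes-Γ₀ (unless M∉ Γ₀-condition))
  , (λ M∉ → normalizes-G₀ (unless M∉ G₀-condition))
  , (λ M≡25 _ → normalizes-Γ₀⁽⁵⁾⁽25⁾ u v M≡25 m<M al)
  where
  instance
    M-nonZero : NonZero M
    M-nonZero = ℕ.≢-nonZero (ℕP.m<n⇒n≢0 m<M)
  open AtkinLehner M m u v al
  Γ₀-condition = proj₁ (All.lookup genusZeroConditions M∈ m<M)
  G₀-condition = proj₂ (All.lookup genusZeroConditions M∈ m<M)
  unless : ∀ {P Q : Set} → ¬ P → P ⊎ Q → Q
  unless ¬p = [ (λ p → contradiction p ¬p) , id ]′
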